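{- For $n\in\mathbb{N}$ let $E_n=3^n+2$. Then for every $n>1$, $E_n$ is not equal to $p+q$ for any prime numbers $p,q$. -}

module Defs where

open import Data.Nat using (ℕ; _+_; _^_)

E : ℕ → ℕ
E n = 3 ^ n + 2

-- E n is odd, so a representation E n = p + q by primes needs one of them to be 2
-- (two odd primes sum to an even number); the other is then 3 ^ n, which for n > 1
-- is divisible by the composite number 9 and hence not prime.
module Submission where

open import Defs
open import Data.Nat using (ℕ; zero; suc; _+_; _*_; _^_; _%_; _<_; _≟_; s≤s; z≤n; NonTrivial)
open import Data.Nat.Divisibility using (∣-refl; m∣m*n; *-monoʳ-∣; m%n≡0⇒n∣m)
open import Data.Nat.DivMod using (m%n<n; %-distribˡ-+; %-distribˡ-*; %-remove-+ʳ)
open import Data.Nat.Primality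
  using (Prime; Composite; composite-≢; composite-∣; composite⇒¬prime; prime⇒irreducible)
open import Data.Nat.Properties using (+-comm; +-cancelˡ-≡; 1+n≢0; <⇒≢; m<m*n; m^n≢0)
open import Data.Sum using (inj₁; inj₂)
open import Relation.Binary.PropositionalEquality
  using (_≡_; _≢_; refl; sym; trans; cong; cong₂; subst; module ≡-Reasoning)
open import Relation.Nullary using (¬_; yes; no; contradiction)

open ≡-Reasoning

square-composite : ∀ m → .{{NonTrivial m}} → Composite (m * m)
square-composite m@(suc (suc _)) = composite-≢ m (<⇒≢ (m<m*n m m (s≤s (s≤s z≤n)))) (m∣m*n m)

^[2+n]-composite : ∀ m n → .{{NonTrivial m}} → Composite (m ^ (2 + n))
^[2+n]-composite m@(suc (suc _)) n =
  composite-∣ {{m^n≢0 m (2 + n)}} (square-composite m) (*-monoʳ-∣ m (m∣m*n {m} (m ^ n)))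

prime≢2⇒odd : ∀ {p} → Prime p → p ≢ 2 → p % 2 ≡ 1
prime≢2⇒odd {p} pr p≢2 with p % 2 in p%2≡r | m%n<n p 2
... | 0 | _ with prime⇒irreducible pr (m%n≡0⇒n∣m p 2 p%2≡r)
...   | inj₁ ()
...   | inj₂ 2≡p = contradiction (sym 2≡p) p≢2
prime≢2⇒odd pr p≢2 | 1 | _ = refl
prime≢2⇒odd pr p≢2 | suc (suc _) | s≤s (s≤s ())

odd⇒odd^ : ∀ {m} n → m % 2 ≡ 1 → m ^ n % 2 ≡ 1
odd⇒odd^ zero _ = refl
odd⇒odd^ {m} (suc n) m-odd = begin
  m * m ^ n % 2                ≡⟨ %-distribˡ-* m (m ^ n) 2 ⟩
  (m % 2) * (m ^ n % 2) % 2    ≡⟨ cong₂ (λ a b → a * b % 2) m-odd (odd⇒odd^ n m-odd) ⟩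
  1                            ∎

odd+odd⇒even : ∀ {m n} → m % 2 ≡ 1 → n % 2 ≡ 1 → (m + n) % 2 ≡ 0
odd+odd⇒even {m} {n} m-odd n-odd = begin
  (m + n) % 2            ≡⟨ %-distribˡ-+ m n 2 ⟩
  (m % 2 + n % 2) % 2    ≡⟨ cong₂ (λ a b → (a + b) % 2) m-odd n-odd ⟩
  0                      ∎

E-odd : ∀ n → E n % 2 ≡ 1
E-odd n = trans (%-remove-+ʳ (3 ^ n) (∣-refl {2})) (odd⇒odd^ n refl)

E[2+n]≢2+prime : ∀ n {q} → Prime q → E (2 + n) ≢ 2 + q
E[2+n]≢2+prime n {q} pq E≡2+q = composite⇒¬prime (^[2+n]-composite 3 n) (subst Prime (sym 3^[2+n]≡q) pq)
  where
  3^[2+n]≡q : 3 ^ (2 + n) ≡ q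
  3^[2+n]≡q = +-cancelˡ-≡ 2 _ _ (trans (+-comm 2 (3 ^ (2 + n))) E≡2+q)

mainTheorem6 : (n : ℕ) → 1 < n → (p q : ℕ) → Prime p → Prime q → ¬ (E n ≡ p + q)
mainTheorem6 1 (s≤s ())
mainTheorem6 (suc (suc m)) _ p q pp pq E≡p+q with p ≟ 2 | q ≟ 2
... | yes refl | _        = E[2+n]≢2+prime m pq E≡p+q
... | no _     | yes refl = E[2+n]≢2+prime m pp (trans E≡p+q (+-comm p 2))
... | no p≢2   | no q≢2   = 1+n≢0 (begin
  1              ≡⟨ sym (E-odd (2 + m)) ⟩
  E (2 + m) % 2  ≡⟨ cong (_% 2) E≡p+q ⟩
  (p + q) % 2    ≡⟨ odd+odd⇒even {p} {q} (prime≢2⇒odd pp p≢2) (prime≢2⇒odd pq q≢2) ⟩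
  0              ∎)
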